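{- Let $n\ge 96$ and let $\mathcal{H}$ be an $n$-vertex $3$-uniform Berge-$K_4$-saturated hypergraph with the minimum number of hyperedges (i.e. $e(\mathcal{H})=\mathrm{sat}_3(n,\text{Berge- }K_4)$). Let $X=\{v\in V(\mathcal{H}): d_{\mathcal{H}}(v)\ge 3\}$, let $A$ be the set of vertices $v\in V(\mathcal{H})\setminus X$ such that every hyperedge containing $v$ intersects $X$, and let $B=V(\mathcal{H})\setminus(X\cup A)$. Then $B=\emptyset$.
   Context: A $3$-graph is a hypergraph all of whose hyperedges have exactly $3$ vertices. Given a graph $F$, a hypergraph is a Berge-$F$ if there is a bijection $\phi:E(F)\to E(\mathcal{H})$ with $\{u,v\}\subseteq\phi(uv)$ for every $uv\in E(F)$. A hypergraph contains a Berge-$F$ if some subset of its hyperedges forms a Berge-$F$. A $3$-graph $\mathcal{H}$ is Berge-$K_4$-saturated if it contains no Berge-$K_4$ but adding any $3$-set of vertices that is not a hyperedge creates a Berge-$K_4$; $\mathrm{sat}_3(n,\text{Berge- }K_4)$ is the minimum number of hyperedges of such a hypergraph on $n$ vertices. $d_{\mathcal{H}}(v)$ is the number of hyperedges containing $v$. -}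

module Defs where

open import Data.Nat using (ℕ; _≤_; _≥_; _<_)
open import Data.Fin using (Fin; zero; suc)
open import Data.Fin.Subset using (Subset; _∈_; _∉_; ∣_∣)
open import Data.Fin.Subset.Properties using (_∈?_)
open import Data.List using (List; _∷_; length; filter; lookup)
open import Data.List.Relation.Unary.All using (All)
open import Data.List.Relation.Unary.Unique.Propositional using (Unique)
import Data.List.Membership.Propositional as LM
open import Data.Product using (Σ; _×_; _,_; ∃; ∃-syntax)
open import Function.Definitions using (Injective)
open import Relation.Binary.PropositionalEquality using (_≡_)
open import Relation.Nullary using (¬_)

record ThreeGraph (n : ℕ) : Set where
  field
    edges   : List (Subset n)
    uniform : All (λ e → ∣ e ∣ ≡ 3) edges
    simple  : Unique edges
open ThreeGraph public

e : ∀ {n} → ThreeGraph n → ℕ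
e H = length (edges H)

deg : ∀ {n} → ThreeGraph n → Fin n → ℕ
deg H v = length (filter (v ∈?_) (edges H))

-- the six edges of K4 on vertex set Fin 4, with their endpoints
k4₁ k4₂ : Fin 6 → Fin 4
k4₁ zero = zero
k4₁ (suc zero) = zero
k4₁ (suc (suc zero)) = zero
k4₁ (suc (suc (suc zero))) = suc zero
k4₁ (suc (suc (suc (suc zero)))) = suc zero
k4₁ (suc (suc (suc (suc (suc zero))))) = suc (suc zero)
k4₂ zero = suc zero
k4₂ (suc zero) = suc (suc zero)
k4₂ (suc (suc zero)) = suc (suc (suc zero))
k4₂ (suc (suc (suc zero))) = suc (suc zero)
k4₂ (suc (suc (suc (suc zero)))) = suc (suc (suc zero))
k4₂ (suc (suc (suc (suc (suc zero))))) = suc (suc (suc zero))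

-- A list of hyperedges contains a Berge-K4: an injective embedding f of the
-- vertices of K4 and an injective assignment φ of distinct hyperedges (list
-- positions) to the edges of K4 such that φ(uv) ⊇ {f u, f v}.
ContainsBergeK4 : ∀ {n} → List (Subset n) → Set
ContainsBergeK4 {n} E =
  Σ (Fin 4 → Fin n) λ f → Injective _≡_ _≡_ f ×
  Σ (Fin 6 → Fin (length E)) λ φ → Injective _≡_ _≡_ φ ×
    (∀ k → (f (k4₁ k) ∈ lookup E (φ k)) × (f (k4₂ k) ∈ lookup E (φ k)))

Saturated : ∀ {n} → ThreeGraph n → Set
Saturated {n} H =
  ¬ ContainsBergeK4 (edges H) ×
  (∀ (s : Subset n) → ∣ s ∣ ≡ 3 → ¬ (s LM.∈ edges H) →
     ContainsBergeK4 (s ∷ edges H))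

MinSaturated : ∀ {n} → ThreeGraph n → Set
MinSaturated {n} H = Saturated H × (∀ (H' : ThreeGraph n) → Saturated H' → e H ≤ e H')

InX : ∀ {n} → ThreeGraph n → Fin n → Set
InX H v = deg H v ≥ 3

InA : ∀ {n} → ThreeGraph n → Fin n → Set
InA H v = ¬ InX H v ×
  (∀ h → h LM.∈ edges H → v ∈ h → ∃[ u ] (u ∈ h × InX H u))

InB : ∀ {n} → ThreeGraph n → Fin n → Set
InB H v = ¬ InX H v × ¬ InA H v

{-# OPTIONS --safe #-}

-- Let h be a hyperedge all of whose vertices have degree at most 2, and
-- v ≠ a two of its vertices. Adding a triple {v, a, z} to a Berge-K4-free
-- H cannot create a Berge-K4: the copy must use the new edge for some K4-edge,
-- one of whose endpoints x lies in h. The three K4-edges at x need three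
-- hyperedges through x, of which only two are old; so one of them is h. The
-- K4-edge carried by h ends at a second vertex y of h, which by the same
-- count must also use the new edge. Then x and y are joined by two K4-edges,
-- which is absurd. By saturation every such triple is already a hyperedge, so
-- v has degree n - 2 ≥ 3. Hence every hyperedge meets X, every vertex outside
-- X lies in A, and B is empty.

module Submission where

open import Defs
open import Data.Bool using (true; false) renaming (_≟_ to _≟ᵇ_)
open import Data.Nat using (ℕ; zero; suc; _≥_; _≤_; _<_; _≤?_; z≤n; s≤s; s≤s⁻¹)
open import Data.Nat.Properties using (≤-refl; ≤-trans; n≤1+n; <⇒≱; m≤m+n)
open import Data.Fin using (Fin; zero; suc; punchIn; punchOut; #_)
open import Data.Fin.Properties
  using (_≟_; any?; all?; 0≢1+n; punchIn-injective; punchInᵢ≢i; punchIn-punchOut;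
         punchOut-injective; injective⇒≤)
open import Data.Fin.Subset using (Subset; _∈_; _∉_; ∣_∣; ⁅_⁆; _∪_; _⊆_; ⊥; inside; outside)
open import Data.Fin.Subset.Properties
  using (_∈?_; x∈⁅x⁆; x∈⁅y⁆⇒x≡y; x∉⁅y⁆⇒x≢y; x∈p∪q⁻; x∈p∪q⁺; ∣⁅x⁆∣≡1; ∣⊥∣≡0;
         p⊆q⇒∣p∣≤∣q∣; ∪-identityˡ)
open import Data.List using (List; []; _∷_; length; filter; lookup)
open import Data.List.Properties using (filter-accept)
open import Data.List.Membership.Propositional using () renaming (_∈_ to _∈ₗ_)
import Data.List.Relation.Unary.All as All
import Data.List.Relation.Unary.Any as Any
open import Data.List.Relation.Unary.Any.Properties using (lookup-index)
open import Data.Product using (_×_; _,_; ∃; ∃-syntax; proj₁; proj₂)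
open import Data.Sum using (_⊎_; inj₁; inj₂)
open import Data.Vec using (Vec; []; _∷_; here; there) renaming (lookup to lookupᵥ)
open import Data.Vec.Properties using (≡-dec)
import Data.Vec.Functional as Vector
open import Function using (_∘_)
open import Function.Definitions using (Injective)
open import Relation.Binary.PropositionalEquality
  using (_≡_; _≢_; refl; sym; trans; cong; subst; subst₂)
open import Relation.Nullary using (¬_; Dec; yes; no; does; contradiction)
open import Relation.Nullary.Decidable
  using (_×-dec_; _⊎-dec_; _→-dec_; ¬?; from-yes; decidable-stable)
open import Relation.Unary using (Pred; Decidable)

module _ {m L : ℕ} (ι : Fin m → Fin (suc L)) (ι≢0 : ∀ t → ι t ≢ zero) where

  lowerNonZero : Fin m → Fin L
  lowerNonZero t = punchOut (ι≢0 t ∘ sym)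

  suc-lowerNonZero : ∀ t → suc (lowerNonZero t) ≡ ι t
  suc-lowerNonZero t = punchIn-punchOut (ι≢0 t ∘ sym)

  lowerNonZero-injective : Injective _≡_ _≡_ ι → Injective _≡_ _≡_ lowerNonZero
  lowerNonZero-injective ι-inj = ι-inj ∘ punchOut-injective (ι≢0 _ ∘ sym) (ι≢0 _ ∘ sym)

lookup-lowerNonZero : ∀ {a m} {A : Set a} (y : A) (ys : List A)
  (ι : Fin m → Fin (length (y ∷ ys))) (ι≢0 : ∀ t → ι t ≢ zero) →
  ∀ t → lookup (y ∷ ys) (ι t) ≡ lookup ys (lowerNonZero ι ι≢0 t)
lookup-lowerNonZero y ys ι ι≢0 t = cong (lookup (y ∷ ys)) (sym (suc-lowerNonZero ι ι≢0 t))

cons-injective : ∀ {a m} {A : Set a} {x : A} {f : Fin m → A} →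
  (∀ t → f t ≢ x) → Injective _≡_ _≡_ f → Injective _≡_ _≡_ (x Vector.∷ f)
cons-injective _   _     {zero}  {zero}   _  = refl
cons-injective f≢x _     {zero}  {suc t'} eq = contradiction (sym eq) (f≢x t')
cons-injective f≢x _     {suc t} {zero}   eq = contradiction eq (f≢x t)
cons-injective _   f-inj {suc t} {suc t'} eq = cong suc (f-inj eq)

module _ {a p} {A : Set a} {P : Pred A p} (P? : Decidable P) where

  length-filter-∷-≤ : ∀ y ys → length (filter P? (y ∷ ys)) ≤ suc (length (filter P? ys))
  length-filter-∷-≤ y ys with does (P? y)
  ... | true  = ≤-refl
  ... | false = n≤1+n _

  length-filter-∷-≥ : ∀ y ys → length (filter P? ys) ≤ length (filter P? (y ∷ ys))
  length-filter-∷-≥ y ys with does (P? y)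
  ... | true  = n≤1+n _
  ... | false = ≤-refl

  injective-positions⇒≤-length-filter : ∀ {m} xs (ι : Fin m → Fin (length xs)) →
    Injective _≡_ _≡_ ι → (∀ t → P (lookup xs (ι t))) → m ≤ length (filter P? xs)
  injective-positions⇒≤-length-filter []       ι ι-inj _ = injective⇒≤ ι-inj
  injective-positions⇒≤-length-filter {zero} (y ∷ ys) ι ι-inj Pι = z≤n
  injective-positions⇒≤-length-filter {suc m} (y ∷ ys) ι ι-inj Pι
    with any? (λ t → ι t ≟ zero)
  ... | no ¬hit = ≤-trans
        (injective-positions⇒≤-length-filter ys (lowerNonZero ι ι≢0)
          (lowerNonZero-injective ι ι≢0 ι-inj)
          (λ t → subst P (lookup-lowerNonZero y ys ι ι≢0 t) (Pι t)))
        (length-filter-∷-≥ y ys)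
    where
      ι≢0 : ∀ t → ι t ≢ zero
      ι≢0 t eq = ¬hit (t , eq)
  ... | yes (t , ιt≡0) =
        subst (suc m ≤_) (sym (cong length (filter-accept P? Py)))
          (s≤s (injective-positions⇒≤-length-filter ys (lowerNonZero ι′ ι′≢0)
            (lowerNonZero-injective ι′ ι′≢0 (punchIn-injective t _ _ ∘ ι-inj))
            (λ u → subst P (lookup-lowerNonZero y ys ι′ ι′≢0 u) (Pι (punchIn t u)))))
    where
      Py : P y
      Py = subst (P ∘ lookup (y ∷ ys)) ιt≡0 (Pι t)
      ι′ : Fin m → Fin (length (y ∷ ys))
      ι′ = ι ∘ punchIn t
      ι′≢0 : ∀ u → ι′ u ≢ zero
      ι′≢0 u eq = punchInᵢ≢i t u (ι-inj (trans eq (sym ιt≡0)))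

∣q∣<∣p∣⇒∃∈p∉q : ∀ {n} {p q : Subset n} → ∣ q ∣ < ∣ p ∣ → ∃ λ x → x ∈ p × x ∉ q
∣q∣<∣p∣⇒∃∈p∉q {p = p} {q} ∣q∣<∣p∣ =
  decidable-stable (any? λ x → (x ∈? p) ×-dec ¬? (x ∈? q)) λ none →
    <⇒≱ ∣q∣<∣p∣ (p⊆q⇒∣p∣≤∣q∣ λ {x} x∈p →
      decidable-stable (x ∈? q) λ x∉q → none (x , x∈p , x∉q))

∣⁅x⁆∪p∣≡1+∣p∣ : ∀ {n} {x : Fin n} {p : Subset n} → x ∉ p → ∣ ⁅ x ⁆ ∪ p ∣ ≡ suc ∣ p ∣
∣⁅x⁆∪p∣≡1+∣p∣ {x = zero}  {inside  ∷ p} x∉p = contradiction here x∉p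
∣⁅x⁆∪p∣≡1+∣p∣ {x = zero}  {outside ∷ p} _   = cong (suc ∘ ∣_∣) (∪-identityˡ p)
∣⁅x⁆∪p∣≡1+∣p∣ {x = suc x} {inside  ∷ p} x∉p = cong suc (∣⁅x⁆∪p∣≡1+∣p∣ (x∉p ∘ there))
∣⁅x⁆∪p∣≡1+∣p∣ {x = suc x} {outside ∷ p} x∉p = ∣⁅x⁆∪p∣≡1+∣p∣ (x∉p ∘ there)

triangle : ∀ {n} → Fin n → Fin n → Fin n → Subset n
triangle x y z = ⁅ x ⁆ ∪ ⁅ y ⁆ ∪ ⁅ z ⁆

module _ {n} {x y z : Fin n} where

  x∈triangle : x ∈ triangle x y z
  x∈triangle = x∈p∪q⁺ (inj₁ (x∈⁅x⁆ x))

  z∈triangle : z ∈ triangle x y z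
  z∈triangle = x∈p∪q⁺ {p = ⁅ x ⁆} (inj₂ (x∈p∪q⁺ {p = ⁅ y ⁆} (inj₂ (x∈⁅x⁆ z))))

  ∈triangle⁻ : ∀ {u} → u ∈ triangle x y z → u ≡ x ⊎ u ≡ y ⊎ u ≡ z
  ∈triangle⁻ u∈ with x∈p∪q⁻ ⁅ x ⁆ (⁅ y ⁆ ∪ ⁅ z ⁆) u∈
  ... | inj₁ u∈x = inj₁ (x∈⁅y⁆⇒x≡y x u∈x)
  ... | inj₂ u∈yz with x∈p∪q⁻ ⁅ y ⁆ ⁅ z ⁆ u∈yz
  ... | inj₁ u∈y = inj₂ (inj₁ (x∈⁅y⁆⇒x≡y y u∈y))
  ... | inj₂ u∈z = inj₂ (inj₂ (x∈⁅y⁆⇒x≡y z u∈z))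

  ∣triangle∣≡3 : x ≢ y → x ≢ z → y ≢ z → ∣ triangle x y z ∣ ≡ 3
  ∣triangle∣≡3 x≢y x≢z y≢z =
    trans (∣⁅x⁆∪p∣≡1+∣p∣ x∉yz) (cong suc (trans (∣⁅x⁆∪p∣≡1+∣p∣ y∉z) (cong suc (∣⁅x⁆∣≡1 z))))
    where
      y∉z : y ∉ ⁅ z ⁆
      y∉z = y≢z ∘ x∈⁅y⁆⇒x≡y z
      x∉yz : x ∉ ⁅ y ⁆ ∪ ⁅ z ⁆
      x∉yz x∈ with x∈p∪q⁻ ⁅ y ⁆ ⁅ z ⁆ x∈
      ... | inj₁ x∈y = x≢y (x∈⁅y⁆⇒x≡y y x∈y)
      ... | inj₂ x∈z = x≢z (x∈⁅y⁆⇒x≡y z x∈z)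

triangle-injectiveʳ : ∀ {n} {x y z z′ : Fin n} → z ≢ x → z ≢ y →
  triangle x y z ≡ triangle x y z′ → z ≡ z′
triangle-injectiveʳ z≢x z≢y eq with ∈triangle⁻ (subst (_ ∈_) eq z∈triangle)
... | inj₁ z≡x        = contradiction z≡x z≢x
... | inj₂ (inj₁ z≡y) = contradiction z≡y z≢y
... | inj₂ (inj₂ z≡z′) = z≡z′

module _ {k} {i j : Fin (suc (suc k))} (i≢j : i ≢ j) where

  punchIn₂ : Fin k → Fin (suc (suc k))
  punchIn₂ t = punchIn i (punchIn (punchOut i≢j) t)

  punchIn₂-injective : Injective _≡_ _≡_ punchIn₂
  punchIn₂-injective = punchIn-injective _ _ _ ∘ punchIn-injective i _ _

  punchIn₂≢i : ∀ t → punchIn₂ t ≢ i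
  punchIn₂≢i t = punchInᵢ≢i i _

  punchIn₂≢j : ∀ t → punchIn₂ t ≢ j
  punchIn₂≢j t eq = punchInᵢ≢i (punchOut i≢j) t
    (punchIn-injective i _ _ (trans eq (sym (punchIn-punchOut i≢j))))

Incident : Fin 4 → Fin 6 → Set
Incident i k = k4₁ k ≡ i ⊎ k4₂ k ≡ i

incident? : ∀ i k → Dec (Incident i k)
incident? i k = (k4₁ k ≟ i) ⊎-dec (k4₂ k ≟ i)

incidentEdge : Fin 4 → Fin 3 → Fin 6
incidentEdge i = lookupᵥ (lookupᵥ table i)
  where
    table : Vec (Vec (Fin 6) 3) 4
    table = (# 0 ∷ # 1 ∷ # 2 ∷ []) ∷ (# 0 ∷ # 3 ∷ # 4 ∷ []) ∷
            (# 1 ∷ # 3 ∷ # 5 ∷ []) ∷ (# 2 ∷ # 4 ∷ # 5 ∷ []) ∷ []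

incidentEdge-incident : ∀ i t → Incident i (incidentEdge i t)
incidentEdge-incident = from-yes (all? λ i → all? λ t → incident? i (incidentEdge i t))

incidentEdge-injective : ∀ i → Injective _≡_ _≡_ (incidentEdge i)
incidentEdge-injective i {t} {t′} = from-yes
  (all? λ i → all? λ t → all? λ t′ → incidentEdge i t ≟ incidentEdge i t′ →-dec t ≟ t′) i t t′

edge-unique : ∀ i j k k′ → i ≢ j → Incident i k → Incident j k →
  Incident i k′ → Incident j k′ → k ≡ k′
edge-unique = from-yes (all? λ i → all? λ j → all? λ k → all? λ k′ →
  ¬? (i ≟ j) →-dec incident? i k →-dec incident? j k →-dec
  incident? i k′ →-dec incident? j k′ →-dec k ≟ k′)

endpoints-distinct : ∀ k → k4₁ k ≢ k4₂ k
endpoints-distinct = from-yes (all? λ k → ¬? (k4₁ k ≟ k4₂ k))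

other-endpoint : ∀ {i k} → Incident i k → ∃ λ j → j ≢ i × Incident j k
other-endpoint {k = k} (inj₁ refl) = k4₂ k , endpoints-distinct k ∘ sym , inj₂ refl
other-endpoint {k = k} (inj₂ refl) = k4₁ k , endpoints-distinct k , inj₁ refl

module _ {n} {f : Fin 4 → Fin n} (f-inj : Injective _≡_ _≡_ f) {p : Subset n} {z : Fin n} where

  endpoint-in : ∀ k → f (k4₁ k) ∈ p ∪ ⁅ z ⁆ → f (k4₂ k) ∈ p ∪ ⁅ z ⁆ →
    ∃ λ i → Incident i k × f i ∈ p
  endpoint-in k x∈ y∈ = pick (x∈p∪q⁻ p ⁅ z ⁆ x∈) (x∈p∪q⁻ p ⁅ z ⁆ y∈)
    where
      pick : f (k4₁ k) ∈ p ⊎ f (k4₁ k) ∈ ⁅ z ⁆ → f (k4₂ k) ∈ p ⊎ f (k4₂ k) ∈ ⁅ z ⁆ →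
        ∃ λ i → Incident i k × f i ∈ p
      pick (inj₁ x∈p) _         = k4₁ k , inj₁ refl , x∈p
      pick (inj₂ _)   (inj₁ y∈p) = k4₂ k , inj₂ refl , y∈p
      pick (inj₂ x≡z) (inj₂ y≡z) = contradiction
        (f-inj (trans (x∈⁅y⁆⇒x≡y z x≡z) (sym (x∈⁅y⁆⇒x≡y z y≡z)))) (endpoints-distinct k)

Covers : ∀ {n} (E : List (Subset n)) → (Fin 4 → Fin n) → (Fin 6 → Fin (length E)) → Set
Covers E f φ = ∀ k → (f (k4₁ k) ∈ lookup E (φ k)) × (f (k4₂ k) ∈ lookup E (φ k))

BergeK4-without-head : ∀ {n} {s} {E : List (Subset n)} f → Injective _≡_ _≡_ f →
  (φ : Fin 6 → Fin (length (s ∷ E))) → Injective _≡_ _≡_ φ → Covers (s ∷ E) f φ →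
  (∀ k → φ k ≢ zero) → ContainsBergeK4 E
BergeK4-without-head {s = s} {E} f f-inj φ φ-inj cover φ≢0 =
  f , f-inj , φ′ , lowerNonZero-injective φ φ≢0 φ-inj , λ k →
    subst (f (k4₁ k) ∈_) (lookup-lowerNonZero s E φ φ≢0 k) (proj₁ (cover k)) ,
    subst (f (k4₂ k) ∈_) (lookup-lowerNonZero s E φ φ≢0 k) (proj₂ (cover k))
  where
    φ′ : Fin 6 → Fin (length E)
    φ′ = lowerNonZero φ φ≢0

AvoidsX : ∀ {n} → ThreeGraph n → Subset n → Set
AvoidsX H h = ∀ {u} → u ∈ h → ¬ InX H u

module EdgeAvoidingX {n} (H : ThreeGraph n) {h} (h∈H : h ∈ₗ edges H) (h-low : AvoidsX H h) where

  private
    E : List (Subset n)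
    E = edges H

    p : Fin (length E)
    p = Any.index h∈H

    h≡E[p] : h ≡ lookup E p
    h≡E[p] = lookup-index h∈H

  module _ {s : Subset n} {u} (u∈h : u ∈ h) (π : Fin 3 → Fin (length (s ∷ E)))
    (π-inj : Injective _≡_ _≡_ π) (u∈π : ∀ t → u ∈ lookup (s ∷ E) (π t)) where

    hits-new-edge : ∃ λ t → π t ≡ zero
    hits-new-edge = decidable-stable (any? λ t → π t ≟ zero) λ ¬hit →
      let π≢0 = λ t eq → ¬hit (t , eq) in
      h-low u∈h (injective-positions⇒≤-length-filter (u ∈?_) E (lowerNonZero π π≢0)
        (lowerNonZero-injective π π≢0 π-inj)
        (λ t → subst (u ∈_) (lookup-lowerNonZero s E π π≢0 t) (u∈π t)))

    -- Otherwise h and the three edges of π are four edges through u in s ∷ E.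
    hits-h : ∃ λ t → π t ≡ suc p
    hits-h = decidable-stable (any? λ t → π t ≟ suc p) λ ¬hit →
      h-low u∈h (s≤s⁻¹ (≤-trans
        (injective-positions⇒≤-length-filter (u ∈?_) (s ∷ E) (suc p Vector.∷ π)
          (cons-injective (λ t eq → ¬hit (t , eq)) π-inj) u∈h∷π)
        (length-filter-∷-≤ (u ∈?_) s E)))
      where
        u∈h∷π : ∀ t → u ∈ lookup (s ∷ E) ((suc p Vector.∷ π) t)
        u∈h∷π zero    = subst (u ∈_) h≡E[p] u∈h
        u∈h∷π (suc t) = u∈π t

  module _ {s z} (s⊆ : s ⊆ h ∪ ⁅ z ⁆) {f} (f-inj : Injective _≡_ _≡_ f)
    {φ : Fin 6 → Fin (length (s ∷ E))} (φ-inj : Injective _≡_ _≡_ φ)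
    (cover : Covers (s ∷ E) f φ) where

    new-edge-unused : ∀ k₀ → φ k₀ ≢ zero
    new-edge-unused k₀ φk₀≡0 =
      let (i₀ , i₀∈k₀ , fi₀∈h) = endpoint-in f-inj k₀ (in-s (inj₁ refl)) (in-s (inj₂ refl))
          (t₀ , φkⱼ≡p) = hits-h fi₀∈h (φ ∘ incidentEdge i₀)
                           (incidentEdge-injective i₀ ∘ φ-inj) (at i₀)
          kⱼ = incidentEdge i₀ t₀
          (i₁ , i₁≢i₀ , i₁∈kⱼ) = other-endpoint (incidentEdge-incident i₀ t₀)
          fi₁∈h = subst (f i₁ ∈_) (trans (cong (lookup (s ∷ E)) φkⱼ≡p) (sym h≡E[p]))
                    (f∈φ i₁∈kⱼ)
          (t₁ , φk≡0) = hits-new-edge fi₁∈h (φ ∘ incidentEdge i₁)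
                          (incidentEdge-injective i₁ ∘ φ-inj) (at i₁)
          i₁∈k₀ = subst (Incident i₁) (φ-inj (trans φk≡0 (sym φk₀≡0)))
                    (incidentEdge-incident i₁ t₁)
          k₀≡kⱼ = edge-unique i₀ i₁ k₀ kⱼ (i₁≢i₀ ∘ sym) i₀∈k₀ i₁∈k₀
                    (incidentEdge-incident i₀ t₀) i₁∈kⱼ
      in 0≢1+n (trans (sym φk₀≡0) (trans (cong φ k₀≡kⱼ) φkⱼ≡p))
      where
        f∈φ : ∀ {i k} → Incident i k → f i ∈ lookup (s ∷ E) (φ k)
        f∈φ {k = k} (inj₁ refl) = proj₁ (cover k)
        f∈φ {k = k} (inj₂ refl) = proj₂ (cover k)

        in-s : ∀ {i} → Incident i k₀ → f i ∈ h ∪ ⁅ z ⁆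
        in-s i∈k₀ = s⊆ (subst (λ j → f _ ∈ lookup (s ∷ E) j) φk₀≡0 (f∈φ i∈k₀))

        at : ∀ i t → f i ∈ lookup (s ∷ E) (φ (incidentEdge i t))
        at i t = f∈φ (incidentEdge-incident i t)

  add-near-h-BergeK4-free : ¬ ContainsBergeK4 E → ∀ {s z} → s ⊆ h ∪ ⁅ z ⁆ →
    ¬ ContainsBergeK4 (s ∷ E)
  add-near-h-BergeK4-free K4-free s⊆ (f , f-inj , φ , φ-inj , cover) =
    K4-free (BergeK4-without-head f f-inj φ φ-inj cover
      (new-edge-unused s⊆ f-inj φ-inj cover))

module _ {k} (H : ThreeGraph (suc (suc k))) (sat : Saturated H) {h} (h∈H : h ∈ₗ edges H)
  (h-low : AvoidsX H h) {v a} (v∈h : v ∈ h) (a∈h : a ∈ h) (v≢a : v ≢ a) where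

  open EdgeAvoidingX H h∈H h-low

  fresh-triangle∈H : ∀ t → triangle v a (punchIn₂ v≢a t) ∈ₗ edges H
  fresh-triangle∈H t =
    decidable-stable (Any.any? (≡-dec _≟ᵇ_ (triangle v a z)) (edges H)) λ triangle∉H →
      add-near-h-BergeK4-free (proj₁ sat) triangle⊆h∪z
        (proj₂ sat _ (∣triangle∣≡3 v≢a (punchIn₂≢i v≢a t ∘ sym) (punchIn₂≢j v≢a t ∘ sym))
          triangle∉H)
    where
      z : Fin (suc (suc k))
      z = punchIn₂ v≢a t

      triangle⊆h∪z : triangle v a z ⊆ h ∪ ⁅ z ⁆
      triangle⊆h∪z u∈ with ∈triangle⁻ u∈
      ... | inj₁ refl        = x∈p∪q⁺ (inj₁ v∈h)
      ... | inj₂ (inj₁ refl) = x∈p∪q⁺ (inj₁ a∈h)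
      ... | inj₂ (inj₂ refl) = x∈p∪q⁺ (inj₂ (x∈⁅x⁆ z))

  k≤deg : k ≤ deg H v
  k≤deg = injective-positions⇒≤-length-filter (v ∈?_) (edges H) position position-injective
    λ t → subst (v ∈_) (lookup-index (fresh-triangle∈H t)) x∈triangle
    where
      position : Fin k → Fin (length (edges H))
      position = Any.index ∘ fresh-triangle∈H

      position-injective : Injective _≡_ _≡_ position
      position-injective {t} {t′} eq = punchIn₂-injective v≢a
        (triangle-injectiveʳ (punchIn₂≢i v≢a t) (punchIn₂≢j v≢a t)
          (trans (lookup-index (fresh-triangle∈H t))
            (trans (cong (lookup (edges H)) eq) (sym (lookup-index (fresh-triangle∈H t′))))))

saturated⇒¬AvoidsX : ∀ {n} → 5 ≤ n → (H : ThreeGraph n) → Saturated H →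
  ∀ {h} → h ∈ₗ edges H → ¬ AvoidsX H h
saturated⇒¬AvoidsX {n} (s≤s (s≤s 3≤k)) H sat {h} h∈H h-low =
  let (v , v∈h , _)   = ∣q∣<∣p∣⇒∃∈p∉q {q = ⊥}
                          (subst₂ _<_ (sym (∣⊥∣≡0 n)) (sym ∣h∣≡3) (s≤s z≤n))
      (a , a∈h , a∉v) = ∣q∣<∣p∣⇒∃∈p∉q {q = ⁅ v ⁆}
                          (subst₂ _<_ (sym (∣⁅x⁆∣≡1 v)) (sym ∣h∣≡3) (s≤s (s≤s z≤n)))
  in h-low v∈h (≤-trans 3≤k (k≤deg H sat h∈H h-low v∈h a∈h (x∉⁅y⁆⇒x≢y a∉v ∘ sym)))
  where
    ∣h∣≡3 : ∣ h ∣ ≡ 3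
    ∣h∣≡3 = All.lookup (uniform H) h∈H

every-edge-meets-X : ∀ {n} → 5 ≤ n → (H : ThreeGraph n) → Saturated H →
  ∀ {h} → h ∈ₗ edges H → ∃[ u ] (u ∈ h × InX H u)
every-edge-meets-X 5≤n H sat {h} h∈H =
  decidable-stable (any? λ u → (u ∈? h) ×-dec (3 ≤? deg H u)) λ none →
    saturated⇒¬AvoidsX 5≤n H sat h∈H λ u∈h u∈X → none (_ , u∈h , u∈X)

lemma3p3 : (n : ℕ) → n ≥ 96 → (H : ThreeGraph n) → MinSaturated H →
    ∀ (v : Fin n) → ¬ InB H v
lemma3p3 n n≥96 H (sat , _) v (v∉X , v∉A) =
  v∉A (v∉X , λ _ h∈H _ → every-edge-meets-X (≤-trans (m≤m+n 5 91) n≥96) H sat h∈H)
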